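{- If $G$ is a connected finite graph of order $n\geqslant 7$, then for every integer $i\geqslant 3$, $D'(G^i)\leqslant 2$.
   Context: Graphs are finite and simple. The distinguishing index $D'(H)$ of a graph $H$ is the least integer $d$ such that there is an edge labeling $E(H)\to\{1,\dots,d\}$ preserved by no non-trivial automorphism of $H$. The $i$-th power $G^i$ is the graph on $V(G)$ in which distinct $x,y$ are adjacent iff $1\leqslant d_G(x,y)\leqslant i$. -}

module Defs where

open import Data.Nat using (ℕ; zero; suc; _≤_; _≥_)
open import Data.Fin using (Fin)
open import Data.Product using (Σ; ∃; _×_; _,_)
open import Data.Empty using (⊥)
open import Relation.Nullary using (¬_)
open import Relation.Binary.PropositionalEquality using (_≡_; _≢_)
open import Function.Bundles using (_↔_; Inverse)

record Graph (n : ℕ) : Set₁ where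
  field
    Adj    : Fin n → Fin n → Set
    sym    : ∀ {x y} → Adj x y → Adj y x
    irrefl : ∀ {x} → ¬ Adj x x
open Graph public

data Walk {n : ℕ} (G : Graph n) : Fin n → Fin n → ℕ → Set where
  here : ∀ {x} → Walk G x x zero
  step : ∀ {x y z k} → Adj G x y → Walk G y z k → Walk G x z (suc k)

DistLE : {n : ℕ} → Graph n → Fin n → Fin n → ℕ → Set
DistLE G x y i = Σ ℕ λ k → k ≤ i × Walk G x y k

Connected : {n : ℕ} → Graph n → Set
Connected G = ∀ x y → Σ ℕ λ k → Walk G x y k

power : {n : ℕ} → Graph n → ℕ → Graph n
power {n} G i = record
  { Adj    = λ x y → (x ≢ y) × DistLE G x y i
  ; sym    = λ { (x≢y , k , k≤i , w) → (λ e → x≢y (symEq e)) , k , k≤i , rev w }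
  ; irrefl = λ { (x≢x , _) → x≢x reflEq }
  }
  where
  open import Relation.Binary.PropositionalEquality using () renaming (sym to symEq; refl to reflEq)
  open import Data.Nat.Properties using (+-comm)
  open import Relation.Binary.PropositionalEquality using (subst)
  snoc : ∀ {x y z k} → Walk G x y k → Adj G y z → Walk G x z (suc k)
  snoc here a = step a here
  snoc (step b w) a = step b (snoc w a)
  rev : ∀ {x y k} → Walk G x y k → Walk G y x k
  rev here = here
  rev (step a w) = snoc (rev w) (Graph.sym G a)

record Automorphism {n : ℕ} (H : Graph n) : Set where
  field
    perm     : Fin n ↔ Fin n
    preserve : ∀ x y → (Adj H x y → Adj H (Inverse.to perm x) (Inverse.to perm y))
                     × (Adj H (Inverse.to perm x) (Inverse.to perm y) → Adj H x y)
  σ : Fin n → Fin n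
  σ = Inverse.to perm
open Automorphism public using (σ)

-- An edge labeling of H with labels {1,…,d} (represented as Fin d):
-- a label for each unordered pair, only values on edges matter.
record EdgeLabeling {n : ℕ} (H : Graph n) (d : ℕ) : Set where
  field
    label    : Fin n → Fin n → Fin d
    symLabel : ∀ x y → label x y ≡ label y x
open EdgeLabeling public

Preserves : {n d : ℕ} {H : Graph n} → Automorphism H → EdgeLabeling H d → Set
Preserves {H = H} φ c = ∀ x y → Adj H x y → label c (σ φ x) (σ φ y) ≡ label c x y

Nontrivial : {n : ℕ} {H : Graph n} → Automorphism H → Set
Nontrivial {n} φ = Σ (Fin n) λ x → σ φ x ≢ x

Distinguishing : {n d : ℕ} {H : Graph n} → EdgeLabeling H d → Set
Distinguishing {H = H} c = (φ : Automorphism H) → Nontrivial φ → ¬ Preserves φ c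

-- D'(H) ≤ d  (D'(H) is the least such d; the property is monotone in d).
DistIndexLE : {n : ℕ} → Graph n → ℕ → Set
DistIndexLE H d = Σ (EdgeLabeling H d) Distinguishing

module Submission where

-- Take a spanning tree of G and root it at a leaf l with neighbour c. As in Sekanina's proof that the
-- cube of a tree is Hamiltonian, each subtree can be toured by a path of G³ that starts at its root and
-- ends within distance 1 of it; the tour of the forest below c runs from some s with d(c,s) ≤ 2 to some
-- e with d(c,e) ≤ 1, so l, e, …, s, c is a Hamiltonian path of G³ ⊆ G^i whose second vertex e is within
-- distance 3 of the last two. Label with 1 exactly the path edges and the two chords e s, e c. The
-- resulting spanning subgraph has no non-trivial automorphism once it has at least 6 vertices: l is its
-- only vertex of degree one, which fixes l, e and the third vertex, and from there the path is forced
-- vertex by vertex. An automorphism of G^i preserving the labelling is an automorphism of this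
-- subgraph, hence the identity.

open import Defs hiding (sym)
open import Data.Nat using (ℕ; zero; suc; _+_; _∸_; _≤_; _<_; _≥_; z≤n; s≤s; _<?_; _≟_)
open import Data.Nat.Properties using (n<1+n; n≤1+n; <-trans; +-comm; +-cancelˡ-≤; m+[n∸m]≡n; ≤-antisym; ≮⇒≥; ≤-refl; ≤-trans; +-mono-≤)
open import Data.Fin using (Fin; zero; suc; fromℕ<)
open import Data.Fin.Properties as Fin using ()
open import Data.Product using (Σ; ∃-syntax; _×_; _,_; proj₂)
open import Data.Sum using (_⊎_; inj₁; inj₂)
open import Data.Sum.Base as Sum using ()
open import Data.Empty using (⊥; ⊥-elim)
open import Function.Bundles using (_↔_; Inverse)
open import Relation.Binary.Core using (_⇒_)
open import Relation.Binary.Definitions using (Decidable; Symmetric; DecidableEquality)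
open import Relation.Binary.PropositionalEquality using (_≡_; refl; sym; trans; cong; subst; subst₂; cong₂; module ≡-Reasoning)
open import Function.Base using (_∘_; id)
open import Data.List using (List; []; _∷_; _++_; length; allFin)
open import Data.List.Properties using (++-assoc; ++-identityʳ; length-++)
open import Data.List.Membership.Propositional using (_∈_; _∉_)
open import Data.List.Membership.Propositional.Properties using (∈-++⁻; ∈-allFin)
import Data.List.Membership.DecPropositional as DecMembership
open import Data.List.Relation.Unary.Any using (here; there)
import Data.List.Membership.Setoid.Properties as Membershipₛ
open import Data.List.Relation.Unary.All as All using (All; []; _∷_)
open import Data.List.Relation.Unary.All.Properties using (¬Any⇒All¬)
open import Data.List.Relation.Unary.AllPairs using ([]; _∷_)
open import Data.List.Relation.Unary.Unique.Propositional using (Unique)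
open import Data.List.Relation.Binary.Subset.Propositional using (_⊆_)
open import Data.List.Relation.Binary.Permutation.Propositional using (_↭_; prep; swap; ↭-refl; ↭-sym; ↭-trans; ↭-reflexive; ↭⇒↭ₛ; module PermutationReasoning)
open import Data.List.Relation.Binary.Permutation.Propositional.Properties using (++⁺; ++⁺ʳ; ++⁺ˡ; shift; ∈-resp-↭; ++-comm; ∷↭∷ʳ)
open import Data.List.Relation.Binary.Permutation.Setoid.Properties using (Unique-resp-↭)
open import Relation.Binary.PropositionalEquality.Properties using (setoid)
open import Relation.Nullary using (¬_; Dec; yes; no; contradiction)
open import Relation.Nullary.Decidable using (map′; _⊎-dec_; _×-dec_)

indicator : {P : Set} → Dec P → Fin 2
indicator (yes _) = suc zero
indicator (no _)  = zero

indicator-cong : {P Q : Set} → (P → Q) → (Q → P) → (p : Dec P) (q : Dec Q) → indicator p ≡ indicator q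
indicator-cong _ _ (yes _) (yes _) = refl
indicator-cong _ _ (no _)  (no _)  = refl
indicator-cong f _ (yes p) (no ¬q) = contradiction (f p) ¬q
indicator-cong _ g (no ¬p) (yes q) = contradiction (g q) ¬p

indicator-reflects : {P Q : Set} (p : Dec P) (q : Dec Q) → indicator p ≡ indicator q → P → Q
indicator-reflects (yes _) (yes q) _  _ = q
indicator-reflects (yes _) (no _)  () _
indicator-reflects (no ¬p) _       _  p = contradiction p ¬p

Rigid : {n : ℕ} → (Fin n → Fin n → Set) → Set
Rigid {n} F = (π : Fin n ↔ Fin n) →
  (∀ x y → F x y → F (Inverse.to π x) (Inverse.to π y)) →
  (∀ x y → F (Inverse.to π x) (Inverse.to π y) → F x y) →
  ∀ x → Inverse.to π x ≡ x

-- Label by the indicator of F: a labelling-preserving automorphism of H is an automorphism of F.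
rigidSubgraph⇒DistIndexLE2 : {n : ℕ} (H : Graph n) {F : Fin n → Fin n → Set} →
  Decidable F → Symmetric F → F ⇒ Adj H → Rigid F → DistIndexLE H 2
rigidSubgraph⇒DistIndexLE2 H {F} F? F-sym F⇒Adj rigid = labelling , distinguishing
  where
  labelling : EdgeLabeling H 2
  labelling = record
    { label    = λ x y → indicator (F? x y)
    ; symLabel = λ x y → indicator-cong F-sym F-sym (F? x y) (F? y x)
    }

  distinguishing : Distinguishing labelling
  distinguishing φ (x , φx≢x) preserves = φx≢x (rigid (Automorphism.perm φ) forward backward x)
    where
    forward : ∀ x y → F x y → F (σ φ x) (σ φ y)
    forward x y f = indicator-reflects (F? x y) (F? _ _) (sym (preserves x y (F⇒Adj f))) f

    backward : ∀ x y → F (σ φ x) (σ φ y) → F x y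
    backward x y f = indicator-reflects (F? _ _) (F? x y)
      (preserves x y (proj₂ (Automorphism.preserve φ x y) (F⇒Adj f))) f

module ChainGraph (M : ℕ) where

  K : ℕ
  K = 6 + M

  -- The path 0 — 1 — ⋯ — (5 + M) with chords from 1 to the last two vertices; only vertices below
  -- K are ever used.
  data Link : ℕ → ℕ → Set where
    next     : ∀ a → Link a (suc a)
    chord₄₊M : Link 1 (4 + M)
    chord₅₊M : Link 1 (5 + M)

  Edge : ℕ → ℕ → Set
  Edge a b = Link a b ⊎ Link b a

  Edge-sym : Symmetric Edge
  Edge-sym = Sum.swap

  Edge-irrefl : ∀ {a} → ¬ Edge a a
  Edge-irrefl (inj₁ ())
  Edge-irrefl (inj₂ ())

  link? : Decidable Link
  link? a b = map′ fromEquations toEquations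
    ((b ≟ suc a) ⊎-dec ((a ≟ 1) ×-dec ((b ≟ 4 + M) ⊎-dec (b ≟ 5 + M))))
    where
    fromEquations : b ≡ suc a ⊎ a ≡ 1 × (b ≡ 4 + M ⊎ b ≡ 5 + M) → Link a b
    fromEquations (inj₁ refl)               = next a
    fromEquations (inj₂ (refl , inj₁ refl)) = chord₄₊M
    fromEquations (inj₂ (refl , inj₂ refl)) = chord₅₊M

    toEquations : Link a b → b ≡ suc a ⊎ a ≡ 1 × (b ≡ 4 + M ⊎ b ≡ 5 + M)
    toEquations (next _) = inj₁ refl
    toEquations chord₄₊M = inj₂ (refl , inj₁ refl)
    toEquations chord₅₊M = inj₂ (refl , inj₂ refl)

  edge? : Decidable Edge
  edge? a b = link? a b ⊎-dec link? b a

  Pendant : ℕ → Set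
  Pendant b = ∀ {c c′} → c < K → c′ < K → Edge b c → Edge b c′ → c ≡ c′

  -- A vertex b > 0 has the two neighbours b - 1 and b + 1, or 4 + M and 1 if it is the last one.
  pendant⇒≡0 : ∀ {b} → b < K → Pendant b → b ≡ 0
  pendant⇒≡0 {zero}  _   _       = refl
  pendant⇒≡0 {suc m} b<K pendant with 2 + m <? K
  ... | yes 2+m<K = contradiction
          (pendant (<-trans (n<1+n m) b<K) 2+m<K (inj₂ (next m)) (inj₁ (next (suc m)))) λ ()
  ... | no 2+m≮K with ≤-antisym b<K (≮⇒≥ 2+m≮K)
  ...   | refl = contradiction
          (pendant (<-trans (n<1+n _) b<K) (s≤s (s≤s z≤n)) (inj₂ (next (4 + M))) (inj₂ chord₅₊M)) λ ()

  record IsAutomorphism (ψ : ℕ → ℕ) : Set where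
    field
      bounded    : ∀ {a} → a < K → ψ a < K
      injective  : ∀ {a b} → a < K → b < K → ψ a ≡ ψ b → a ≡ b
      surjective : ∀ {b} → b < K → ∃[ a ] a < K × ψ a ≡ b
      edge       : ∀ {a b} → a < K → b < K → Edge a b → Edge (ψ a) (ψ b)
      edge⁻      : ∀ {a b} → a < K → b < K → Edge (ψ a) (ψ b) → Edge a b

  private
    0<K : 0 < K
    0<K = s≤s z≤n
    1<K : 1 < K
    1<K = s≤s (s≤s z≤n)
    2<K : 2 < K
    2<K = s≤s (s≤s (s≤s z≤n))
    4+M<K : 4 + M < K
    4+M<K = <-trans (n<1+n _) (n<1+n _)
    5+M<K : 5 + M < K
    5+M<K = n<1+n _

  neighbour-of-0 : ∀ {b} → Edge 0 b → b ≡ 1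
  neighbour-of-0 (inj₁ (next 0)) = refl
  neighbour-of-0 (inj₂ ())

  -- The neighbours of 2 are 1 and 3, and 3 is not adjacent to 1 because 4 + M > 3.
  no-common-neighbour-1-2 : ∀ {w} → Edge 2 w → Edge w 1 → ⊥
  no-common-neighbour-1-2 (inj₁ (next 2)) (inj₁ ())
  no-common-neighbour-1-2 (inj₁ (next 2)) (inj₂ ())
  no-common-neighbour-1-2 (inj₂ (next 1)) w1 = Edge-irrefl w1

  -- 0 is fixed as the only pendant vertex, hence so is its neighbour 1, and then 2; from there on each
  -- vertex is the only neighbour of its predecessor that is not yet fixed.
  rigid : ∀ {ψ} → IsAutomorphism ψ → ∀ a → a < K → ψ a ≡ a
  rigid {ψ} aut = fixed
    where
    open IsAutomorphism aut

    ψ0≡0 : ψ 0 ≡ 0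
    ψ0≡0 = pendant⇒≡0 (bounded 0<K) λ c<K c′<K e e′ →
      trans (neighbour-of-ψ0 c<K e) (sym (neighbour-of-ψ0 c′<K e′))
      where
      neighbour-of-ψ0 : ∀ {c} → c < K → Edge (ψ 0) c → c ≡ ψ 1
      neighbour-of-ψ0 c<K e with surjective c<K
      ... | a , a<K , refl = cong ψ (neighbour-of-0 (edge⁻ 0<K a<K e))

    ψ1≡1 : ψ 1 ≡ 1
    ψ1≡1 = neighbour-of-0 (subst (λ z → Edge z (ψ 1)) ψ0≡0 (edge 0<K 1<K (inj₁ (next 0))))

    ψ2≡2 : ψ 2 ≡ 2
    ψ2≡2 = neighbour-of-1 refl (subst (λ z → Edge z (ψ 2)) ψ1≡1 (edge 1<K 2<K (inj₁ (next 1))))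
      where
      -- Were ψ 2 one of 4 + M and 5 + M, the other would be a common neighbour of ψ 2 and ψ 1.
      no-common-neighbour : ∀ {c d} → ψ 2 ≡ c → d < K → Edge c d → Edge d 1 → ⊥
      no-common-neighbour ψ2≡c d<K cd d1 with surjective d<K
      ... | w , w<K , refl = no-common-neighbour-1-2
        (edge⁻ 2<K w<K (subst (λ z → Edge z (ψ w)) (sym ψ2≡c) cd))
        (edge⁻ w<K 1<K (subst (Edge (ψ w)) (sym ψ1≡1) d1))

      neighbour-of-1 : ∀ {c} → ψ 2 ≡ c → Edge 1 c → c ≡ 2
      neighbour-of-1 _   (inj₁ (next 1)) = refl
      neighbour-of-1 eq  (inj₁ chord₄₊M) =
        ⊥-elim (no-common-neighbour eq 5+M<K (inj₁ (next (4 + M))) (inj₂ chord₅₊M))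
      neighbour-of-1 eq  (inj₁ chord₅₊M) =
        ⊥-elim (no-common-neighbour eq 4+M<K (inj₂ (next (4 + M))) (inj₂ chord₄₊M))
      neighbour-of-1 eq  (inj₂ (next 0)) = contradiction (injective 2<K 0<K (trans eq (sym ψ0≡0))) λ ()

    extend : ∀ {a} → ψ (suc a) ≡ suc a → ψ (2 + a) ≡ 2 + a → 3 + a < K → ψ (3 + a) ≡ 3 + a
    extend {a} fix₁ fix₂ 3+a<K = successor refl
      (subst (λ z → Edge z (ψ (3 + a))) fix₂ (edge 2+a<K 3+a<K (inj₁ (next (2 + a)))))
      where
      2+a<K : 2 + a < K
      2+a<K = <-trans (n<1+n _) 3+a<K

      successor : ∀ {c} → ψ (3 + a) ≡ c → Edge (2 + a) c → c ≡ 3 + a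
      successor _  (inj₁ (next _)) = refl
      successor eq (inj₂ (next _)) =
        contradiction (injective 3+a<K (<-trans (n<1+n _) 2+a<K) (trans eq (sym fix₁))) λ ()
      successor eq (inj₂ chord₄₊M) = contradiction (injective 3+a<K 1<K (trans eq (sym ψ1≡1))) λ ()
      successor eq (inj₂ chord₅₊M) = contradiction (injective 3+a<K 1<K (trans eq (sym ψ1≡1))) λ ()

    fixed : ∀ a → a < K → ψ a ≡ a
    fixed 0 _ = ψ0≡0
    fixed 1 _ = ψ1≡1
    fixed 2 _ = ψ2≡2
    fixed (suc (suc (suc a))) 3+a<K = extend
      (fixed (suc a) (<-trans (n<1+n _) (<-trans (n<1+n _) 3+a<K)))
      (fixed (suc (suc a)) (<-trans (n<1+n _) 3+a<K))
      3+a<K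

module _ {A : Set} where

  lookupOr : A → List A → ℕ → A
  lookupOr d []       _       = d
  lookupOr d (x ∷ xs) zero    = x
  lookupOr d (x ∷ xs) (suc a) = lookupOr d xs a

  lookupOr-∈ : ∀ d {xs a} → a < length xs → lookupOr d xs a ∈ xs
  lookupOr-∈ d {x ∷ xs} {zero}  _         = here refl
  lookupOr-∈ d {x ∷ xs} {suc a} (s≤s a<n) = there (lookupOr-∈ d a<n)

  lookupOr-length : ∀ d xs {y ys} → lookupOr d (xs ++ y ∷ ys) (length xs) ≡ y
  lookupOr-length d []       = refl
  lookupOr-length d (x ∷ xs) = lookupOr-length d xs

module _ {A : Set} (_≟_ : DecidableEquality A) where

  position : A → List A → ℕ
  position x []       = 0
  position x (y ∷ ys) with x ≟ y
  ... | yes _ = 0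
  ... | no _  = suc (position x ys)

  position<length : ∀ {x xs} → x ∈ xs → position x xs < length xs
  position<length {x} {y ∷ ys} x∈ with x ≟ y | x∈
  ... | yes _   | _         = s≤s z≤n
  ... | no x≢y  | here x≡y  = contradiction x≡y x≢y
  ... | no _    | there x∈ys = s≤s (position<length x∈ys)

  lookupOr-position : ∀ d {x xs} → x ∈ xs → lookupOr d xs (position x xs) ≡ x
  lookupOr-position d {x} {y ∷ ys} x∈ with x ≟ y | x∈
  ... | yes x≡y | _          = sym x≡y
  ... | no x≢y  | here x≡y   = contradiction x≡y x≢y
  ... | no _    | there x∈ys = lookupOr-position d x∈ys

  position-lookupOr : ∀ d {xs a} → Unique xs → a < length xs → position (lookupOr d xs a) xs ≡ a
  position-lookupOr d {x ∷ xs} {zero} _ _ with x ≟ x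
  ... | yes _  = refl
  ... | no x≢x = contradiction refl x≢x
  position-lookupOr d {x ∷ xs} {suc a} (x∉xs ∷ u) (s≤s a<n) with lookupOr d xs a ≟ x
  ... | yes y≡x = contradiction (sym y≡x) (All.lookup x∉xs (lookupOr-∈ d a<n))
  ... | no _    = cong suc (position-lookupOr d u a<n)

EachOnce : ∀ {n} → List (Fin n) → Set
EachOnce xs = Unique xs × (∀ y → y ∈ xs)

EachOnce-resp-↭ : ∀ {n} {xs ys : List (Fin n)} → xs ↭ ys → EachOnce xs → EachOnce ys
EachOnce-resp-↭ xs↭ys (u , covering) =
  Unique-resp-↭ (setoid _) (↭⇒↭ₛ xs↭ys) u , λ y → ∈-resp-↭ xs↭ys (covering y)

covering⇒≤length : ∀ {n} {xs : List (Fin n)} → (∀ y → y ∈ xs) → n ≤ length xs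
covering⇒≤length {n} {xs} covering = Fin.injective⇒≤ λ {y} {y′} eq →
  Membershipₛ.index-injective (setoid (Fin n)) (covering y) (covering y′) eq

record Enumeration (n K : ℕ) : Set where
  field
    vertexAt       : ℕ → Fin n
    index          : Fin n → ℕ
    index<K        : ∀ x → index x < K
    vertexAt-index : ∀ x → vertexAt (index x) ≡ x
    index-vertexAt : ∀ {a} → a < K → index (vertexAt a) ≡ a

  index-injective : ∀ {x y} → index x ≡ index y → x ≡ y
  index-injective {x} {y} eq = begin
    x                  ≡⟨ vertexAt-index x ⟨
    vertexAt (index x) ≡⟨ cong vertexAt eq ⟩
    vertexAt (index y) ≡⟨ vertexAt-index y ⟩
    y                  ∎
    where open ≡-Reasoning

enumerate : ∀ {n K} (d : Fin n) (xs : List (Fin n)) → EachOnce xs → length xs ≡ K → Enumeration n K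
enumerate d xs (u , covering) length≡K = record
  { vertexAt       = lookupOr d xs
  ; index          = λ x → position Fin._≟_ x xs
  ; index<K        = λ x → subst (_ <_) length≡K (position<length Fin._≟_ (covering x))
  ; vertexAt-index = λ x → lookupOr-position Fin._≟_ d (covering x)
  ; index-vertexAt = λ a<K → position-lookupOr Fin._≟_ d u (subst (_ <_) (sym length≡K) a<K)
  }

module _ {n M : ℕ} (e : Enumeration n (6 + M)) where
  open Enumeration e
  open ChainGraph M using (Edge; IsAutomorphism; rigid)

  ChainEdge : Fin n → Fin n → Set
  ChainEdge x y = Edge (index x) (index y)

  ChainEdge-rigid : Rigid ChainEdge
  ChainEdge-rigid π hom hom⁻ x = index-injective (begin
      index (to x)                      ≡⟨ cong (index ∘ to) (vertexAt-index x) ⟨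
      ψ (index x)                       ≡⟨ rigid ψ-automorphism (index x) (index<K x) ⟩
      index x                           ∎)
    where
    open Inverse π using (to; from; strictlyInverseˡ; strictlyInverseʳ)
    open ≡-Reasoning

    ψ : ℕ → ℕ
    ψ a = index (to (vertexAt a))

    to-injective : ∀ {x y} → to x ≡ to y → x ≡ y
    to-injective {x} {y} eq = trans (sym (strictlyInverseʳ x)) (trans (cong from eq) (strictlyInverseʳ y))

    ψ-automorphism : IsAutomorphism ψ
    ψ-automorphism = record
      { bounded    = λ _ → index<K _
      ; injective  = λ {a} {b} a<K b<K ψa≡ψb → begin
          a                   ≡⟨ index-vertexAt a<K ⟨
          index (vertexAt a)  ≡⟨ cong index (to-injective (index-injective ψa≡ψb)) ⟩
          index (vertexAt b)  ≡⟨ index-vertexAt b<K ⟩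
          b                   ∎
      ; surjective = λ {b} b<K → index (from (vertexAt b)) , index<K _ , (begin
          index (to (vertexAt (index (from (vertexAt b))))) ≡⟨ cong (index ∘ to) (vertexAt-index _) ⟩
          index (to (from (vertexAt b)))                     ≡⟨ cong index (strictlyInverseˡ _) ⟩
          index (vertexAt b)                                 ≡⟨ index-vertexAt b<K ⟩
          b                                                  ∎)
      ; edge       = λ {a} {b} a<K b<K ab → hom (vertexAt a) (vertexAt b)
          (subst₂ Edge (sym (index-vertexAt a<K)) (sym (index-vertexAt b<K)) ab)
      ; edge⁻      = λ {a} {b} a<K b<K ψaψb →
          subst₂ Edge (index-vertexAt a<K) (index-vertexAt b<K) (hom⁻ (vertexAt a) (vertexAt b) ψaψb)
      }

module _ {n : ℕ} (G : Graph n) where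
  open DecMembership (Fin._≟_ {n}) using (_∈?_)

  snocWalk : ∀ {x y z k} → Walk G x y k → Adj G y z → Walk G x z (suc k)
  snocWalk here       yz = step yz here
  snocWalk (step e w) yz = step e (snocWalk w yz)

  reverseWalk : ∀ {x y k} → Walk G x y k → Walk G y x k
  reverseWalk here       = here
  reverseWalk (step e w) = snocWalk (reverseWalk w) (Graph.sym G e)

  appendWalk : ∀ {x y z k l} → Walk G x y k → Walk G y z l → Walk G x z (k + l)
  appendWalk here       v = v
  appendWalk (step e w) v = step e (appendWalk w v)

  DistLE-refl : ∀ {x d} → DistLE G x x d
  DistLE-refl = 0 , z≤n , here

  DistLE-sym : ∀ {x y d} → DistLE G x y d → DistLE G y x d
  DistLE-sym (k , k≤d , w) = k , k≤d , reverseWalk w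

  DistLE-trans : ∀ {x y z d e} → DistLE G x y d → DistLE G y z e → DistLE G x z (d + e)
  DistLE-trans (k , k≤d , w) (l , l≤e , v) = k + l , +-mono-≤ k≤d l≤e , appendWalk w v

  DistLE-mono : ∀ {x y d e} → d ≤ e → DistLE G x y d → DistLE G x y e
  DistLE-mono d≤e (k , k≤d , w) = k , ≤-trans k≤d d≤e , w

  Adj⇒DistLE : ∀ {x y} → Adj G x y → DistLE G x y 1
  Adj⇒DistLE e = 1 , ≤-refl , step e here

  data Tree : Fin n → Set
  data Forest (v : Fin n) : Set

  data Tree where
    node : (v : Fin n) → Forest v → Tree v

  data Forest v where
    []    : Forest v
    child : ∀ {c} → Adj G v c → Tree c → Forest v → Forest v

  treeVertices : ∀ {v} → Tree v → List (Fin n)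
  forestVertices : ∀ {v} → Forest v → List (Fin n)
  treeVertices (node v f)      = v ∷ forestVertices f
  forestVertices []            = []
  forestVertices (child _ t f) = treeVertices t ++ forestVertices f

  root∈treeVertices : ∀ {v} (t : Tree v) → v ∈ treeVertices t
  root∈treeVertices (node v f) = here refl

  graft : ∀ {r a b} (t : Tree r) → a ∈ treeVertices t → Adj G a b →
          Σ (Tree r) λ t′ → treeVertices t′ ↭ b ∷ treeVertices t
  graftForest : ∀ {v a b} (f : Forest v) → a ∈ forestVertices f → Adj G a b →
                Σ (Forest v) λ f′ → forestVertices f′ ↭ b ∷ forestVertices f

  graft (node v f) (here refl) ab = node v (child ab (node _ []) f) , swap v _ ↭-refl
  graft (node v f) (there a∈f) ab with graftForest f a∈f ab
  ... | f′ , f′↭ = node v f′ , ↭-trans (prep v f′↭) (swap v _ ↭-refl)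

  graftForest (child vc t f) a∈ ab with ∈-++⁻ (treeVertices t) a∈
  ... | inj₁ a∈t with graft t a∈t ab
  ...   | t′ , t′↭ = child vc t′ f , ++⁺ʳ _ t′↭
  graftForest (child vc t f) a∈ ab | inj₂ a∈f with graftForest f a∈f ab
  ...   | f′ , f′↭ = child vc t f′ , ↭-trans (++⁺ˡ (treeVertices t) f′↭) (shift _ (treeVertices t) _)

  Extension : ∀ {r} → Tree r → Fin n → Set
  Extension {r} t y = Σ (Tree r) λ t′ →
    Unique (treeVertices t′) × y ∈ treeVertices t′ × treeVertices t ⊆ treeVertices t′

  graftNew : ∀ {r a b} (t : Tree r) → Unique (treeVertices t) → a ∈ treeVertices t → Adj G a b →
             b ∉ treeVertices t → Extension t b
  graftNew t u a∈t ab b∉t with graft t a∈t ab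
  ... | t′ , t′↭ =
    t′ ,
    Unique-resp-↭ (setoid _) (↭⇒↭ₛ (↭-sym t′↭)) (¬Any⇒All¬ _ b∉t ∷ u) ,
    ∈-resp-↭ (↭-sym t′↭) (here refl) ,
    ∈-resp-↭ (↭-sym t′↭) ∘ there

  absorbWalk : ∀ {r x y k} (t : Tree r) → Unique (treeVertices t) → x ∈ treeVertices t →
               Walk G x y k → Extension t y
  absorbWalk t u x∈t here = t , u , x∈t , id
  absorbWalk t u x∈t (step {y = z} xz w) with z ∈? treeVertices t
  ... | yes z∈t = absorbWalk t u z∈t w
  ... | no z∉t =
    let t₁ , u₁ , z∈t₁ , t⊆t₁ = graftNew t u x∈t xz z∉t
        t₂ , u₂ , y∈t₂ , t₁⊆t₂ = absorbWalk t₁ u₁ z∈t₁ w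
    in t₂ , u₂ , y∈t₂ , t₁⊆t₂ ∘ t⊆t₁

  spanningTree : Connected G → (r : Fin n) → Σ (Tree r) λ t → EachOnce (treeVertices t)
  spanningTree conn r =
    let t , u , covered = spanning (allFin n) in t , u , λ y → All.lookup covered (∈-allFin y)
    where
    spanning : (ys : List (Fin n)) → Σ (Tree r) λ t → Unique (treeVertices t) × All (_∈ treeVertices t) ys
    spanning []       = node r [] , [] ∷ [] , []
    spanning (y ∷ ys) =
      let t , u , ys⊆t = spanning ys
          t′ , u′ , y∈t′ , t⊆t′ = absorbWalk t u (root∈treeVertices t) (proj₂ (conn r y))
      in t′ , u′ , y∈t′ ∷ All.map t⊆t′ ys⊆t

  data Planted : Set where
    plant : (l : Fin n) {u : Fin n} → Adj G l u → Tree u → Planted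

  plantedVertices : Planted → List (Fin n)
  plantedVertices (plant l _ t) = l ∷ treeVertices t

  -- Descend along first children to a leaf of s and hang everything else below it.
  replant : ∀ {v u} (s : Tree v) → Adj G v u → (t : Tree u) →
            Σ Planted λ p → plantedVertices p ↭ treeVertices s ++ treeVertices t
  replant (node v [])             vu t = plant v vu t , ↭-refl
  replant (node v (child vc c f)) vu t with replant c (Graph.sym G vc) (node v (child vu t f))
  ... | p , p↭ = p , (begin
      plantedVertices p ↭⟨ p↭ ⟩
      C ++ v ∷ T ++ F   ↭⟨ shift v C (T ++ F) ⟩
      v ∷ C ++ T ++ F   ↭⟨ prep v (++⁺ˡ C (++-comm T F)) ⟩
      v ∷ C ++ F ++ T   ≡⟨ cong (v ∷_) (++-assoc C F T) ⟨
      v ∷ (C ++ F) ++ T ∎)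
    where
    open PermutationReasoning
    C T F : List (Fin n)
    C = treeVertices c
    T = treeVertices t
    F = forestVertices f

  data CubePath : Fin n → Fin n → Set where
    done : ∀ {x} → CubePath x x
    hop  : ∀ {x y z} → DistLE G x y 3 → CubePath y z → CubePath x z

  pathVertices : ∀ {x y} → CubePath x y → List (Fin n)
  laterVertices : ∀ {x y} → CubePath x y → List (Fin n)
  pathVertices {x} p        = x ∷ laterVertices p
  laterVertices done        = []
  laterVertices (hop _ p)   = pathVertices p

  joinPath : ∀ {x y z w} → CubePath x y → DistLE G y z 3 → CubePath z w → CubePath x w
  joinPath done       yz q = hop yz q
  joinPath (hop xy p) yz q = hop xy (joinPath p yz q)

  joinPath-vertices : ∀ {x y z w} (p : CubePath x y) (yz : DistLE G y z 3) (q : CubePath z w) →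
                      pathVertices (joinPath p yz q) ≡ pathVertices p ++ pathVertices q
  joinPath-vertices done       yz q = refl
  joinPath-vertices {x} (hop xy p) yz q = cong (x ∷_) (joinPath-vertices p yz q)

  reversePath : ∀ {x y} → CubePath x y → CubePath y x
  reversePath done       = done
  reversePath (hop xy p) = joinPath (reversePath p) (DistLE-sym xy) done

  reversePath-vertices : ∀ {x y} (p : CubePath x y) → pathVertices (reversePath p) ↭ pathVertices p
  reversePath-vertices done = ↭-refl
  reversePath-vertices {x} (hop xy p) = begin
    pathVertices (joinPath (reversePath p) (DistLE-sym xy) done) ≡⟨ joinPath-vertices (reversePath p) _ done ⟩
    pathVertices (reversePath p) ++ x ∷ []                       ↭⟨ ++⁺ʳ _ (reversePath-vertices p) ⟩
    pathVertices p ++ x ∷ []                                     ↭⟨ ∷↭∷ʳ x (pathVertices p) ⟨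
    x ∷ pathVertices p                                           ∎
    where open PermutationReasoning

  data TreeTour (v : Fin n) (X : List (Fin n)) : Set where
    tour : ∀ {e} (p : CubePath v e) → DistLE G v e 1 → pathVertices p ↭ X → TreeTour v X

  data ForestTour (v : Fin n) (X : List (Fin n)) : Set where
    tour : ∀ {s e} (p : CubePath s e) → DistLE G v s 2 → DistLE G v e 1 → pathVertices p ↭ X →
           ForestTour v X

  treeTour : ∀ {v} (t : Tree v) → TreeTour v (treeVertices t)
  forestTour : ∀ {v c} (vc : Adj G v c) (t : Tree c) (f : Forest v) →
               ForestTour v (forestVertices (child vc t f))

  treeTour (node v [])             = tour done DistLE-refl ↭-refl
  treeTour (node v (child vc t f)) with forestTour vc t f
  ... | tour p vs ve p↭ = tour (hop (DistLE-mono (n≤1+n 2) vs) p) ve (prep v p↭)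

  forestTour vc t [] with treeTour t
  ... | tour p ce p↭ =
    tour (reversePath p) (DistLE-trans (Adj⇒DistLE vc) ce) (Adj⇒DistLE vc)
      (↭-trans (reversePath-vertices p) (↭-trans p↭ (↭-reflexive (sym (++-identityʳ _)))))
  forestTour vc t (child vc′ t′ f) with treeTour t | forestTour vc′ t′ f
  ... | tour p ce p↭ | tour q vs ve q↭ =
    tour (joinPath (reversePath p) (DistLE-trans (DistLE-sym (Adj⇒DistLE vc)) vs) q)
      (DistLE-trans (Adj⇒DistLE vc) ce) ve
      (↭-trans (↭-reflexive (joinPath-vertices (reversePath p) _ q))
        (++⁺ (↭-trans (reversePath-vertices p) p↭) q↭))

  lookupOr-consecutive : ∀ d {x y} (p : CubePath x y) {a} → suc a < length (pathVertices p) →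
    DistLE G (lookupOr d (pathVertices p) a) (lookupOr d (pathVertices p) (suc a)) 3
  lookupOr-consecutive d done       (s≤s ())
  lookupOr-consecutive d (hop xy p) {zero}  _          = xy
  lookupOr-consecutive d (hop xy p) {suc a} (s≤s a<n) = lookupOr-consecutive d p a<n

  lookupOr-end : ∀ d {x y} (p : CubePath x y) ys →
                 lookupOr d (pathVertices p ++ ys) (length (laterVertices p)) ≡ y
  lookupOr-end d done      ys = refl
  lookupOr-end d (hop _ p) ys = lookupOr-end d p ys

  data ChordedTour (X : List (Fin n)) : Set where
    chordedTour : ∀ {l e s c} (le : DistLE G l e 3) (R : CubePath e s) (sc : DistLE G s c 3) →
                  DistLE G e s 3 → DistLE G e c 3 → pathVertices (hop le (joinPath R sc done)) ↭ X →
                  ChordedTour X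

  plantedTour : (p : Planted) → 2 < length (plantedVertices p) → ChordedTour (plantedVertices p)
  plantedTour (plant l lc (node c [])) (s≤s (s≤s ()))
  plantedTour (plant l lc (node c (child cd t f))) _ with forestTour cd t f
  ... | tour {s} {e} q cs ce q↭ =
    chordedTour le R sc es (DistLE-mono (s≤s z≤n) (DistLE-sym ce)) (begin
      l ∷ pathVertices (joinPath R sc done) ≡⟨ cong (l ∷_) (joinPath-vertices R sc done) ⟩
      l ∷ pathVertices R ++ c ∷ []          ↭⟨ prep l (++⁺ʳ _ (reversePath-vertices q)) ⟩
      l ∷ pathVertices q ++ c ∷ []          ↭⟨ prep l (∷↭∷ʳ c (pathVertices q)) ⟨
      l ∷ c ∷ pathVertices q                ↭⟨ prep l (prep c q↭) ⟩
      l ∷ c ∷ forestVertices (child cd t f) ∎)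
    where
    open PermutationReasoning
    R : CubePath e s
    R = reversePath q
    le : DistLE G l e 3
    le = DistLE-mono (n≤1+n 2) (DistLE-trans (Adj⇒DistLE lc) ce)
    sc : DistLE G s c 3
    sc = DistLE-mono (n≤1+n 2) (DistLE-sym cs)
    es : DistLE G e s 3
    es = DistLE-trans (DistLE-sym ce) cs

  spanningPlanted : 2 ≤ n → Connected G → Σ Planted λ p → EachOnce (plantedVertices p)
  spanningPlanted 2≤n conn with spanningTree conn (fromℕ< (≤-trans (s≤s z≤n) 2≤n))
  ... | node r [] , _ , covering =
    contradiction (≤-trans 2≤n (covering⇒≤length covering)) λ { (s≤s ()) }
  ... | node r (child rc c f) , once with replant c (Graph.sym G rc) (node r f)
  ...   | p , p↭ = p , EachOnce-resp-↭ (↭-sym (↭-trans p↭ (shift r _ _))) once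

  record ChainInCube : Set where
    field
      M           : ℕ
      enumeration : Enumeration n (6 + M)
      near        : ∀ {a b} → a < 6 + M → b < 6 + M → ChainGraph.Edge M a b →
                    DistLE G (Enumeration.vertexAt enumeration a) (Enumeration.vertexAt enumeration b) 3

  chordedTour⇒chainInCube : ∀ {X} → 6 ≤ n → ChordedTour X → EachOnce X → ChainInCube
  chordedTour⇒chainInCube 6≤n (chordedTour {l} {e} {s} {c} le R sc es ec P↭) X-once = record
    { M           = M
    ; enumeration = enumerate l S S-once length-S
    ; near        = near
    }
    where
    open ChainGraph using (Link; next; chord₄₊M; chord₅₊M)
    open ≡-Reasoning

    J : CubePath e c
    J = joinPath R sc done
    S : List (Fin n)
    S = l ∷ pathVertices J
    S-once : EachOnce S
    S-once = EachOnce-resp-↭ (↭-sym P↭) X-once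

    L : ℕ
    L = length (laterVertices R)
    length-S-L : length S ≡ 3 + L
    length-S-L = begin
      suc (length (pathVertices J))             ≡⟨ cong (suc ∘ length) (joinPath-vertices R sc done) ⟩
      suc (length (pathVertices R ++ c ∷ []))   ≡⟨ cong suc (length-++ (pathVertices R)) ⟩
      suc (suc L + 1)                           ≡⟨ cong suc (+-comm (suc L) 1) ⟩
      3 + L                                     ∎
    3≤L : 3 ≤ L
    3≤L = +-cancelˡ-≤ 3 3 L (subst (6 ≤_) length-S-L (≤-trans 6≤n (covering⇒≤length (proj₂ S-once))))
    M : ℕ
    M = L ∸ 3
    L≡3+M : L ≡ 3 + M
    L≡3+M = sym (m+[n∸m]≡n 3≤L)
    length-S : length S ≡ 6 + M
    length-S = trans length-S-L (cong (3 +_) L≡3+M)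

    -- e is at position 1 by computation; s and c take the last two places.
    s-at-4+M : lookupOr l S (4 + M) ≡ s
    s-at-4+M = begin
      lookupOr l (pathVertices J) (3 + M)
        ≡⟨ cong₂ (lookupOr l) (joinPath-vertices R sc done) (sym L≡3+M) ⟩
      lookupOr l (pathVertices R ++ c ∷ []) L
        ≡⟨ lookupOr-end l R _ ⟩
      s ∎
    c-at-5+M : lookupOr l S (5 + M) ≡ c
    c-at-5+M = begin
      lookupOr l (pathVertices J) (4 + M)
        ≡⟨ cong₂ (lookupOr l) (joinPath-vertices R sc done) (sym (cong suc L≡3+M)) ⟩
      lookupOr l (pathVertices R ++ c ∷ []) (length (pathVertices R))
        ≡⟨ lookupOr-length l (pathVertices R) ⟩
      c ∎

    nearLink : ∀ {a b} → b < 6 + M → Link M a b → DistLE G (lookupOr l S a) (lookupOr l S b) 3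
    nearLink b<K (next a) = lookupOr-consecutive l (hop le J) (subst (suc a <_) (sym length-S) b<K)
    nearLink _   chord₄₊M = subst (λ y → DistLE G e y 3) (sym s-at-4+M) es
    nearLink _   chord₅₊M = subst (λ y → DistLE G e y 3) (sym c-at-5+M) ec

    near : ∀ {a b} → a < 6 + M → b < 6 + M → ChainGraph.Edge M a b →
           DistLE G (lookupOr l S a) (lookupOr l S b) 3
    near a<K b<K (inj₁ ab) = nearLink b<K ab
    near a<K b<K (inj₂ ba) = DistLE-sym (nearLink a<K ba)

  chainInCube : 6 ≤ n → Connected G → ChainInCube
  chainInCube 6≤n conn =
    let p , p-once = spanningPlanted (≤-trans (s≤s (s≤s z≤n)) 6≤n) conn
        3≤|p| = ≤-trans (s≤s (s≤s (s≤s z≤n))) (≤-trans 6≤n (covering⇒≤length (proj₂ p-once)))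
    in chordedTour⇒chainInCube 6≤n (plantedTour p 3≤|p|) p-once

distIndex-power≤2 : ∀ {n} (G : Graph n) → 6 ≤ n → Connected G → ∀ {i} → 3 ≤ i →
                    DistIndexLE (power G i) 2
distIndex-power≤2 G 6≤n conn {i} 3≤i =
  rigidSubgraph⇒DistIndexLE2 (power G i) (λ x y → edge? (index x) (index y)) Edge-sym
    ChainEdge⇒Adj (ChainEdge-rigid enumeration)
  where
  open ChainInCube (chainInCube G 6≤n conn)
  open Enumeration enumeration
  open ChainGraph M using (edge?; Edge-sym; Edge-irrefl)

  ChainEdge⇒Adj : ChainEdge enumeration ⇒ Adj (power G i)
  ChainEdge⇒Adj {x} {y} xy =
    (λ x≡y → Edge-irrefl (subst (ChainEdge enumeration x) (sym x≡y) xy)) ,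
    DistLE-mono G 3≤i (subst₂ (λ u v → DistLE G u v 3) (vertexAt-index x) (vertexAt-index y)
      (near (index<K x) (index<K y) xy))

corollary2p7 : (n : ℕ) → n ≥ 7 → (G : Graph n) → Connected G →
               (i : ℕ) → i ≥ 3 → DistIndexLE (power G i) 2
corollary2p7 n n≥7 G conn i i≥3 = distIndex-power≤2 G (≤-trans (n≤1+n 6) n≥7) conn i≥3
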